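{- For the Online Variable-size Drone Scheduling problem, the algorithm VariableSizeDS (defined in the context) is $(2\alpha+1)$-competitive, i.e. the number of drones it uses is at most $(2\alpha+1)\cdot\mathrm{OPT}$, where $\alpha$ is the ratio between the maximum and the minimum battery capacity of the drones, and $\mathrm{OPT}$ is the optimal number of colors (drones) in the offline version in which all intervals with their costs and all drones with their battery capacities are known in advance.
   Context: Online Variable-size Drone Scheduling (OVDS): a finite set $\mathcal{I}$ of closed intervals (customer requests), each with a positive cost (battery consumption), is known in advance. Drones arrive online one at a time upon request, each with a battery capacity revealed only upon arrival; every drone's capacity is at least the maximum cost of an interval. Each interval must be assigned to a drone (a color) so that intervals assigned to the same drone are pairwise disjoint and their total cost does not exceed that drone's capacity; the goal is to minimize the number of drones used. Algorithm VariableSizeDS: process the intervals in increasing order of left endpoint and give each interval as idNumber the smallest positive integer not used by any previously processed interval that overlaps it; let $g$ be the number of idNumbers used. For each $i=1,\dots,g$, let $List_i$ be the intervals with idNumber $i$, sorted in non-decreasing order of cost. For each $i$, while $List_i$ is non-empty: request a new drone with capacity $b$, set its remaining capacity to $b$, and go through $List_i$ in sorted order, assigning each interval to this drone and removing it from the list as long as its cost is at most the remaining capacity (decreasing the remaining capacity accordingly), stopping at the first interval that does not fit. -}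

module Defs where

open import Data.Nat using (ℕ; zero; suc; _+_; _*_; _∸_; _≤_; _<_; _≤?_; _⊔_)
import Data.Nat as ℕ
open import Data.Fin using (Fin)
import Data.Fin as Fin
open import Data.List using (List; []; _∷_; map; filter; length; foldr; upTo; allFin)
open import Data.Nat.ListAction using (sum)
open import Data.List.Membership.DecPropositional ℕ._≟_ using (_∈?_)
open import Data.Product using (_×_; _,_; proj₁; proj₂)
open import Relation.Nullary using (Dec; yes; no; ¬_)
open import Relation.Nullary.Decidable using (_×-dec_)
open import Relation.Binary.PropositionalEquality using (_≡_; _≢_)
open import Function using (_∘_)
open import Function.Definitions using (Injective)

-- Intervals (customer requests): closed interval [left , right] with a cost

record Interval : Set where
  constructor mkInterval
  field
    left  : ℕ
    right : ℕ
    cost  : ℕ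
open Interval public

Overlaps : Interval → Interval → Set
Overlaps x y = (left x ≤ right y) × (left y ≤ right x)

overlaps? : (x y : Interval) → Dec (Overlaps x y)
overlaps? x y = (left x ≤? right y) ×-dec (left y ≤? right x)

smallestFrom : ℕ → ℕ → List ℕ → ℕ
smallestFrom zero     k used = k
smallestFrom (suc f) k used with k ∈? used
... | yes _ = smallestFrom f (suc k) used
... | no  _ = k

-- smallest positive integer not in 'used' (one of 1 .. length used + 1 is free)
smallestPos : List ℕ → ℕ
smallestPos used = smallestFrom (length used) 1 used

module _ {n : ℕ} (I : Fin n → Interval) where

  -- acc : already processed intervals with their idNumbers
  assignIds : List (Fin n × ℕ) → List (Fin n) → List (Fin n × ℕ)
  assignIds acc []       = acc
  assignIds acc (x ∷ xs) =
    assignIds ((x , smallestPos (map proj₂ (filter (λ p → overlaps? (I x) (I (proj₁ p))) acc))) ∷ acc) xs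

  -- number of idNumbers used (the maximum idNumber; 0 if no interval)
  numIds : List (Fin n × ℕ) → ℕ
  numIds = foldr (λ p m → proj₂ p ⊔ m) 0

  listOf : List (Fin n × ℕ) → ℕ → List Interval
  listOf ids i = map (I ∘ proj₁) (filter (λ p → proj₂ p ℕ.≟ i) ids)

insertByCost : Interval → List Interval → List Interval
insertByCost x [] = x ∷ []
insertByCost x (y ∷ ys) with cost x ≤? cost y
... | yes _ = x ∷ y ∷ ys
... | no  _ = y ∷ insertByCost x ys

sortByCost : List Interval → List Interval
sortByCost = foldr insertByCost []

fill : ℕ → List Interval → List Interval
fill r [] = []
fill r (x ∷ xs) with cost x ≤? r
... | yes _ = fill (r ∸ cost x) xs
... | no  _ = x ∷ xs

-- drones are numbered 0,1,2,...; drone d has capacity cap d.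
-- packList fuel cap d L : index of the next drone to request after
-- packing L starting with drone d. (Fuel = length L suffices since every
-- drone takes at least one interval when all costs are ≤ all capacities.)
packList : ℕ → (ℕ → ℕ) → ℕ → List Interval → ℕ
packList _       cap d []         = d
packList zero    cap d (_ ∷ _)    = d
packList (suc f) cap d L@(_ ∷ _) = packList f cap (suc d) (fill (cap d) L)

packAll : (ℕ → ℕ) → ℕ → List (List Interval) → ℕ
packAll cap d []       = d
packAll cap d (L ∷ Ls) = packAll cap (packList (length L) cap d L) Ls

-- Number of drones used by VariableSizeDS on intervals I, processed in
-- order P (increasing left endpoint), with online capacities cap.
VariableSizeDS : {n : ℕ} → (Fin n → Interval) → List (Fin n) → (ℕ → ℕ) → ℕ
VariableSizeDS I P cap =
  let ids = assignIds I [] P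
      g   = numIds I ids
  in packAll cap 0 (map (λ i → sortByCost (listOf I ids i)) (map suc (upTo g)))

record OfflineSchedule {n : ℕ} (I : Fin n → Interval) (cap : ℕ → ℕ) (k : ℕ) : Set where
  field
    drone     : Fin k → ℕ                 -- which drone plays colour c
    distinct  : Injective _≡_ _≡_ drone
    colour    : Fin n → Fin k
    disjoint  : ∀ i j → i ≢ j → colour i ≡ colour j → ¬ Overlaps (I i) (I j)
    capacity  : ∀ c → sum (map (cost ∘ I) (filter (λ i → colour i Fin.≟ c) (allFin n)))
                        ≤ cap (drone c)

{-# OPTIONS --safe #-}
-- Phase 1 is first fit in order of left endpoints, so when an interval x receives idNumber m,
-- the intervals holding 1, …, m − 1 all overlap x and start no later than x: together with x
-- they contain the left endpoint of x. These m intervals need m distinct drones in any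
-- feasible schedule, hence g ≤ OPT. In phase 2 every drone of a class except the last one
-- overflows: its load plus the cost of the next interval, which is part of the next drone's
-- load, exceeds its capacity ≥ bmin. Charging each overflow to these two loads gives
-- (drones of a class − 1) · bmin ≤ 2 · (cost of the class), so summing over the classes,
-- drones · bmin ≤ 2 · (total cost) + g · bmin ≤ 2 · OPT · bmax + OPT · bmin.
module Submission where

open import Defs
open import Data.Nat using (ℕ; zero; suc; _+_; _*_; _∸_; _≤_; _<_; _≤?_; _<?_; z≤n; s≤s)
import Data.Nat as ℕ
open import Data.Nat.Properties
open import Data.Nat.ListAction using (sum)
open import Data.Nat.ListAction.Properties using (sum-++; sum-↭)
open import Data.Nat.Solver using (module +-*-Solver)
open import Data.Fin using (Fin; toℕ) renaming (zero to fzero; suc to fsuc)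
import Data.Fin as Fin
open import Data.Fin.Properties using (pigeonhole; toℕ<n; toℕ-injective) renaming (<⇒≢ to <⇒≢ᶠ)
open import Data.List using (List; []; _∷_; _++_; map; filter; length; upTo; allFin)
open import Data.List.Properties
  using (map-++; map-∘; map-cong; length-map; length-upTo; length-tabulate; ++-identityʳ)
open import Data.List.Membership.Propositional using (_∈_)
open import Data.List.Membership.Propositional.Properties using (∈-map⁻; ∈-filter⁻; ∈-allFin)
open import Data.List.Membership.DecPropositional ℕ._≟_ using (_∈?_)
open import Data.List.Relation.Unary.Any using (here; there)
open import Data.List.Relation.Unary.All using (All; []; _∷_)
import Data.List.Relation.Unary.All as All
open import Data.List.Relation.Unary.All.Properties using (++⁻ʳ) renaming (map⁺ to All-map⁺)
open import Data.List.Relation.Unary.AllPairs using (AllPairs; []; _∷_)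
import Data.List.Relation.Unary.AllPairs as AllPairs
open import Data.List.Relation.Unary.Unique.Propositional using (Unique)
import Data.List.Relation.Unary.Unique.Propositional.Properties as Unique
open import Data.List.Relation.Binary.Permutation.Propositional
  using (_↭_; prep; swap; ↭-refl; ↭-trans; ↭-sym; ↭⇒↭ₛ)
open import Data.List.Relation.Binary.Permutation.Propositional.Properties
  using (All-resp-↭; shift) renaming (map⁺ to ↭-map⁺)
import Data.List.Relation.Binary.Permutation.Setoid.Properties as Permutationₛ
open import Data.Product using (Σ; ∃; _×_; _,_; proj₁; proj₂)
open import Data.Sum using (inj₁; inj₂)
open import Data.Empty using (⊥-elim)
open import Function using (_∘_)
open import Function.Definitions using (Injective)
open import Relation.Nullary using (yes; no; ¬_)
open import Relation.Binary.Definitions using (DecidableEquality)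
open import Relation.Binary.PropositionalEquality

open +-*-Solver

sum-map-+ : ∀ {A : Set} (f g : A → ℕ) xs →
            sum (map (λ x → f x + g x) xs) ≡ sum (map f xs) + sum (map g xs)
sum-map-+ f g []       = refl
sum-map-+ f g (x ∷ xs) = begin
  f x + g x + sum (map (λ x → f x + g x) xs)
    ≡⟨ cong (f x + g x +_) (sum-map-+ f g xs) ⟩
  f x + g x + (sum (map f xs) + sum (map g xs))
    ≡⟨ solve 4 (λ a b c d → a :+ b :+ (c :+ d) := a :+ c :+ (b :+ d)) refl
               (f x) (g x) (sum (map f xs)) (sum (map g xs)) ⟩
  f x + sum (map f xs) + (g x + sum (map g xs))
    ∎
  where open ≡-Reasoning

sum-map-≤-length* : ∀ {A : Set} (f : A → ℕ) {c} → (∀ x → f x ≤ c) → ∀ xs →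
                    sum (map f xs) ≤ length xs * c
sum-map-≤-length* f f≤c []       = z≤n
sum-map-≤-length* f f≤c (x ∷ xs) = +-mono-≤ (f≤c x) (sum-map-≤-length* f f≤c xs)

module Classes {A B : Set} (_≟_ : DecidableEquality B) (key : A → B) (w : A → ℕ) where

  classWeight : B → List A → ℕ
  classWeight b xs = sum (map w (filter (λ x → key x ≟ b) xs))

  δ : A → B → ℕ
  δ x b with key x ≟ b
  ... | yes _ = w x
  ... | no  _ = 0

  classWeight-∷ : ∀ b x xs → classWeight b (x ∷ xs) ≡ δ x b + classWeight b xs
  classWeight-∷ b x xs with key x ≟ b
  ... | yes _ = refl
  ... | no  _ = refl

  sum-classWeight-∷ : ∀ bs x xs →
    sum (map (λ b → classWeight b (x ∷ xs)) bs)
      ≡ sum (map (δ x) bs) + sum (map (λ b → classWeight b xs) bs)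
  sum-classWeight-∷ bs x xs = begin
    sum (map (λ b → classWeight b (x ∷ xs)) bs)   ≡⟨ cong sum (map-cong (λ b → classWeight-∷ b x xs) bs) ⟩
    sum (map (λ b → δ x b + classWeight b xs) bs) ≡⟨ sum-map-+ (δ x) (λ b → classWeight b xs) bs ⟩
    sum (map (δ x) bs) + sum (map (λ b → classWeight b xs) bs) ∎
    where open ≡-Reasoning

  sum-δ≡0 : ∀ x bs → All (key x ≢_) bs → sum (map (δ x) bs) ≡ 0
  sum-δ≡0 x []       []           = refl
  sum-δ≡0 x (b ∷ bs) (x≢b ∷ x≢bs) with key x ≟ b
  ... | yes x≡b = ⊥-elim (x≢b x≡b)
  ... | no  _   = sum-δ≡0 x bs x≢bs

  sum-δ≤ : ∀ x bs → Unique bs → sum (map (δ x) bs) ≤ w x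
  sum-δ≤ x []       _           = z≤n
  sum-δ≤ x (b ∷ bs) (b∉bs ∷ bs!) with key x ≟ b
  ... | yes refl = ≤-reflexive (trans (cong (w x +_) (sum-δ≡0 x bs b∉bs)) (+-identityʳ (w x)))
  ... | no  _    = sum-δ≤ x bs bs!

  sum-δ≥ : ∀ x {bs} → key x ∈ bs → w x ≤ sum (map (δ x) bs)
  sum-δ≥ x {b ∷ bs} (here x≡b) with key x ≟ b
  ... | yes _   = m≤m+n (w x) _
  ... | no  x≢b = ⊥-elim (x≢b x≡b)
  sum-δ≥ x {b ∷ bs} (there x∈bs) = ≤-trans (sum-δ≥ x x∈bs) (m≤n+m _ (δ x b))

  sum-classWeight≤ : ∀ {bs} → Unique bs → ∀ xs →
                     sum (map (λ b → classWeight b xs) bs) ≤ sum (map w xs)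
  sum-classWeight≤ {bs} bs! [] =
    ≤-trans (sum-map-≤-length* _ (λ _ → ≤-refl) bs) (≤-reflexive (*-zeroʳ (length bs)))
  sum-classWeight≤ {bs} bs! (x ∷ xs) = begin
    sum (map (λ b → classWeight b (x ∷ xs)) bs)                ≡⟨ sum-classWeight-∷ bs x xs ⟩
    sum (map (δ x) bs) + sum (map (λ b → classWeight b xs) bs) ≤⟨ +-mono-≤ (sum-δ≤ x bs bs!)
                                                                             (sum-classWeight≤ bs! xs) ⟩
    w x + sum (map w xs)                                        ∎
    where open ≤-Reasoning

  sum-classWeight≥ : ∀ {bs} → (∀ x → key x ∈ bs) → ∀ xs →
                     sum (map w xs) ≤ sum (map (λ b → classWeight b xs) bs)
  sum-classWeight≥ keys∈bs [] = z≤n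
  sum-classWeight≥ {bs} keys∈bs (x ∷ xs) = begin
    w x + sum (map w xs)                                        ≤⟨ +-mono-≤ (sum-δ≥ x (keys∈bs x))
                                                                             (sum-classWeight≥ keys∈bs xs) ⟩
    sum (map (δ x) bs) + sum (map (λ b → classWeight b xs) bs) ≡⟨ sum-classWeight-∷ bs x xs ⟨
    sum (map (λ b → classWeight b (x ∷ xs)) bs)                ∎
    where open ≤-Reasoning

totalCost : List Interval → ℕ
totalCost L = sum (map cost L)

insertByCost-↭ : ∀ x L → insertByCost x L ↭ x ∷ L
insertByCost-↭ x []       = ↭-refl
insertByCost-↭ x (y ∷ ys) with cost x ≤? cost y
... | yes _ = ↭-refl
... | no  _ = ↭-trans (prep y (insertByCost-↭ x ys)) (swap y x ↭-refl)

sortByCost-↭ : ∀ L → sortByCost L ↭ L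
sortByCost-↭ []      = ↭-refl
sortByCost-↭ (x ∷ L) = ↭-trans (insertByCost-↭ x (sortByCost L)) (prep x (sortByCost-↭ L))

totalCost-sortByCost : ∀ L → totalCost (sortByCost L) ≡ totalCost L
totalCost-sortByCost L = sum-↭ (↭-map⁺ cost (sortByCost-↭ L))

All-sortByCost : ∀ {P : Interval → Set} {L} → All P L → All P (sortByCost L)
All-sortByCost {L = L} = All-resp-↭ (↭-sym (sortByCost-↭ L))

taken : ℕ → List Interval → List Interval
taken r [] = []
taken r (x ∷ xs) with cost x ≤? r
... | yes _ = x ∷ taken (r ∸ cost x) xs
... | no  _ = []

taken++fill : ∀ r L → taken r L ++ fill r L ≡ L
taken++fill r []       = refl
taken++fill r (x ∷ xs) with cost x ≤? r
... | yes _ = cong (x ∷_) (taken++fill (r ∸ cost x) xs)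
... | no  _ = refl

totalCost-taken+fill : ∀ r L → totalCost L ≡ totalCost (taken r L) + totalCost (fill r L)
totalCost-taken+fill r L = begin
  totalCost L                                       ≡⟨ cong totalCost (taken++fill r L) ⟨
  totalCost (taken r L ++ fill r L)                 ≡⟨ cong sum (map-++ cost (taken r L) (fill r L)) ⟩
  sum (map cost (taken r L) ++ map cost (fill r L)) ≡⟨ sum-++ (map cost (taken r L)) _ ⟩
  totalCost (taken r L) + totalCost (fill r L)      ∎
  where open ≡-Reasoning

cost≤totalCost-taken : ∀ r x xs → cost x ≤ r → cost x ≤ totalCost (taken r (x ∷ xs))
cost≤totalCost-taken r x xs x≤r with cost x ≤? r
... | yes _   = m≤m+n (cost x) _
... | no  x≰r = ⊥-elim (x≰r x≤r)

fill-overflows : ∀ r L {y ys} → fill r L ≡ y ∷ ys → r < totalCost (taken r L) + cost y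
fill-overflows r (x ∷ xs) eq with cost x ≤? r | eq
... | no  x≰r | refl = ≰⇒> x≰r
... | yes x≤r | eq′  = begin-strict
  r                                                ≡⟨ m+[n∸m]≡n x≤r ⟨
  cost x + (r ∸ cost x)                            <⟨ +-monoʳ-< (cost x) (fill-overflows (r ∸ cost x) xs eq′) ⟩
  cost x + (totalCost (taken (r ∸ cost x) xs) + _) ≡⟨ +-assoc (cost x) _ _ ⟨
  cost x + totalCost (taken (r ∸ cost x) xs) + _   ∎
  where open ≤-Reasoning

module Packing (cap : ℕ → ℕ) {b : ℕ} (b≤cap : ∀ d → b ≤ cap d) where

  Fits : Interval → Set
  Fits x = ∀ d → cost x ≤ cap d

  All-Fits-fill : ∀ r {L} → All Fits L → All Fits (fill r L)
  All-Fits-fill r {L} L-fits = ++⁻ʳ (taken r L) (subst (All Fits) (sym (taken++fill r L)) L-fits)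

  private
    overflow-pays : ∀ {p D r t cx cy} → p + cy ≤ b + D + 2 * r → cx ≤ t → b ≤ t + cy →
                    p + cx ≤ D + 2 * (t + r)
    overflow-pays {p} {D} {r} {t} {cx} {cy} ih cx≤t b≤t+cy = +-cancelʳ-≤ (b + cy) _ _ (begin
      p + cx + (b + cy)              ≡⟨ solve 4 (λ p cx b cy → p :+ cx :+ (b :+ cy) := p :+ cy :+ (cx :+ b))
                                              refl p cx b cy ⟩
      p + cy + (cx + b)              ≤⟨ +-mono-≤ ih (+-mono-≤ cx≤t b≤t+cy) ⟩
      b + D + 2 * r + (t + (t + cy)) ≡⟨ solve 5 (λ b D r t cy → b :+ D :+ con 2 :* r :+ (t :+ (t :+ cy))
                                                              := D :+ con 2 :* (t :+ r) :+ (b :+ cy))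
                                              refl b D r t cy ⟩
      D + 2 * (t + r) + (b + cy)     ∎)
      where open ≤-Reasoning

  -- The cost of the first interval is carried as a credit: the overflow of the previous
  -- drone pays for it.
  packList-∷-bound : ∀ f d x xs → All Fits (x ∷ xs) →
                     packList f cap d (x ∷ xs) * b + cost x ≤ suc d * b + 2 * totalCost (x ∷ xs)
  packList-∷-bound zero    d x xs _ =
    +-mono-≤ (m≤n+m (d * b) b) (≤-trans (m≤m+n (cost x) _) (m≤n*m _ 2))
  packList-∷-bound (suc f) d x xs L-fits@(x-fits ∷ _) = continue (fill (cap d) L) refl
    where
    L : List Interval
    L = x ∷ xs
    T : ℕ
    T = totalCost (taken (cap d) L)
    x≤T : cost x ≤ T
    x≤T = cost≤totalCost-taken (cap d) x xs (x-fits d)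
    T≤L : T ≤ totalCost L
    T≤L = ≤-trans (m≤m+n T _) (≤-reflexive (sym (totalCost-taken+fill (cap d) L)))
    continue : ∀ R → fill (cap d) L ≡ R →
               packList f cap (suc d) R * b + cost x ≤ suc d * b + 2 * totalCost L
    continue []       _  = +-monoʳ-≤ (suc d * b) (≤-trans x≤T (≤-trans T≤L (m≤n*m _ 2)))
    continue (y ∷ ys) eq = begin
      packList f cap (suc d) (y ∷ ys) * b + cost x      ≤⟨ overflow-pays ih x≤T b≤T+y ⟩
      suc d * b + 2 * (T + totalCost (y ∷ ys))          ≡⟨ cong (λ R → suc d * b + 2 * (T + totalCost R)) eq ⟨
      suc d * b + 2 * (T + totalCost (fill (cap d) L))  ≡⟨ cong (λ c → suc d * b + 2 * c) (totalCost-taken+fill (cap d) L) ⟨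
      suc d * b + 2 * totalCost L                       ∎
      where
      open ≤-Reasoning
      ih : packList f cap (suc d) (y ∷ ys) * b + cost y ≤ suc (suc d) * b + 2 * totalCost (y ∷ ys)
      ih = packList-∷-bound f (suc d) y ys (subst (All Fits) eq (All-Fits-fill (cap d) L-fits))
      b≤T+y : b ≤ T + cost y
      b≤T+y = <⇒≤ (≤-<-trans (b≤cap d) (fill-overflows (cap d) L eq))

  packList-bound : ∀ f d L → All Fits L → packList f cap d L * b ≤ d * b + (2 * totalCost L + b)
  packList-bound f d []       _      = m≤m+n (d * b) _
  packList-bound f d (x ∷ xs) L-fits = begin
    packList f cap d (x ∷ xs) * b          ≤⟨ m≤m+n _ (cost x) ⟩
    packList f cap d (x ∷ xs) * b + cost x ≤⟨ packList-∷-bound f d x xs L-fits ⟩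
    b + d * b + 2 * totalCost (x ∷ xs)     ≡⟨ solve 3 (λ b db c → b :+ db :+ con 2 :* c := db :+ (con 2 :* c :+ b))
                                                      refl b (d * b) (totalCost (x ∷ xs)) ⟩
    d * b + (2 * totalCost (x ∷ xs) + b)   ∎
    where open ≤-Reasoning

  packAll-bound : ∀ d Ls → All (All Fits) Ls →
                  packAll cap d Ls * b ≤ d * b + (2 * sum (map totalCost Ls) + length Ls * b)
  packAll-bound d []       []                = m≤m+n (d * b) 0
  packAll-bound d (L ∷ Ls) (L-fits ∷ Ls-fit) = begin
    packAll cap d′ Ls * b
      ≤⟨ packAll-bound d′ Ls Ls-fit ⟩
    d′ * b + (2 * sum (map totalCost Ls) + length Ls * b)
      ≤⟨ +-monoˡ-≤ _ (packList-bound (length L) d L L-fits) ⟩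
    d * b + (2 * totalCost L + b) + (2 * sum (map totalCost Ls) + length Ls * b)
      ≡⟨ solve 5 (λ db c b s l → db :+ (con 2 :* c :+ b) :+ (con 2 :* s :+ l)
                                 := db :+ (con 2 :* (c :+ s) :+ (b :+ l)))
                 refl (d * b) (totalCost L) b (sum (map totalCost Ls)) (length Ls * b) ⟩
    d * b + (2 * sum (map totalCost (L ∷ Ls)) + length (L ∷ Ls) * b)
      ∎
    where
    open ≤-Reasoning
    d′ : ℕ
    d′ = packList (length L) cap d L

record Covers (J : Interval) (p : ℕ) : Set where
  constructor covers
  field
    left≤  : left J ≤ p
    ≤right : p ≤ right J

covers-overlap : ∀ {J J′ p} → Covers J p → Covers J′ p → Overlaps J J′
covers-overlap (covers l≤p p≤r) (covers l′≤p p≤r′) = ≤-trans l≤p p≤r′ , ≤-trans l′≤p p≤r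

clique≤colours : ∀ {n k m} (I : Fin n → Interval) {colour : Fin n → Fin k} →
  (∀ i j → i ≢ j → colour i ≡ colour j → ¬ Overlaps (I i) (I j)) →
  ∀ p (W : Fin m → Fin n) → Injective _≡_ _≡_ W → (∀ a → Covers (I (W a)) p) → m ≤ k
clique≤colours {k = k} {m} I {colour} proper p W W-injective W-covers with k <? m
... | no  k≮m = ≮⇒≥ k≮m
... | yes k<m with pigeonhole k<m (colour ∘ W)
...   | a , a′ , a<a′ , same-colour = ⊥-elim (proper (W a) (W a′)
  (λ Wa≡Wa′ → <⇒≢ᶠ a<a′ (W-injective {a} {a′} Wa≡Wa′)) same-colour
  (covers-overlap (W-covers a) (W-covers a′)))

∈-below-smallestFrom : ∀ f s used {j} → s ≤ j → j < smallestFrom f s used → j ∈ used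
∈-below-smallestFrom zero    s used s≤j j<s = ⊥-elim (<⇒≱ j<s s≤j)
∈-below-smallestFrom (suc f) s used s≤j j<r with s ∈? used
... | no  _   = ⊥-elim (<⇒≱ j<r s≤j)
... | yes s∈used with m≤n⇒m<n∨m≡n s≤j
...   | inj₂ refl = s∈used
...   | inj₁ s<j  = ∈-below-smallestFrom f (suc s) used s<j j<r

module FirstFit {n k : ℕ} (I : Fin n → Interval)
  (nonempty : ∀ i → left (I i) ≤ right (I i))
  (clique≤k : ∀ {m} p (W : Fin m → Fin n) → Injective _≡_ _≡_ W → (∀ a → Covers (I (W a)) p) → m ≤ k)
  where

  Sorted : List (Fin n) → Set
  Sorted = AllPairs (λ i j → left (I i) ≤ left (I j))

  record Invariant (acc : List (Fin n × ℕ)) (rest : List (Fin n)) : Set where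
    field
      functional : ∀ {e e′} → e ∈ acc → e′ ∈ acc → proj₁ e ≡ proj₁ e′ → proj₂ e ≡ proj₂ e′
      fresh      : ∀ {e y} → e ∈ acc → y ∈ rest → proj₁ e ≢ y
      earlier    : ∀ {e y} → e ∈ acc → y ∈ rest → left (I (proj₁ e)) ≤ left (I y)
      unique     : Unique rest
      sorted     : Sorted rest

  usedIds : Fin n → List (Fin n × ℕ) → List ℕ
  usedIds x acc = map proj₂ (filter (λ e → overlaps? (I x) (I (proj₁ e))) acc)

  module _ {acc x xs} (inv : Invariant acc (x ∷ xs)) where
    open Invariant inv

    Holder : ℕ → Set
    Holder j = Σ (Fin n × ℕ) λ e → e ∈ acc × proj₂ e ≡ j × Covers (I (proj₁ e)) (left (I x))

    holder : ∀ {j} → 1 ≤ j → j < smallestPos (usedIds x acc) → Holder j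
    holder 1≤j j<m with ∈-map⁻ proj₂ (∈-below-smallestFrom (length (usedIds x acc)) 1 (usedIds x acc) 1≤j j<m)
    ... | e , e∈f , refl with ∈-filter⁻ (λ e → overlaps? (I x) (I (proj₁ e))) {xs = acc} e∈f
    ...   | e∈acc , x∩e = e , e∈acc , refl , covers (earlier e∈acc (here refl)) (proj₁ x∩e)

    clique-of-holders : ∀ m → (∀ {j} → 1 ≤ j → j < m → Holder j) → m ≤ k
    clique-of-holders zero    _       = z≤n
    clique-of-holders (suc m) holders = clique≤k (left (I x)) W W-injective W-covers
      where
      H : (t : Fin m) → Holder (suc (toℕ t))
      H t = holders (s≤s z≤n) (s≤s (toℕ<n t))
      W : Fin (suc m) → Fin n
      W fzero    = x
      W (fsuc t) = proj₁ (proj₁ (H t))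
      W-covers : ∀ a → Covers (I (W a)) (left (I x))
      W-covers fzero    = covers ≤-refl (nonempty x)
      W-covers (fsuc t) = proj₂ (proj₂ (proj₂ (H t)))
      W-injective : Injective _≡_ _≡_ W
      W-injective {fzero}  {fzero}  _   = refl
      W-injective {fzero}  {fsuc t} x≡W = ⊥-elim (fresh (proj₁ (proj₂ (H t))) (here refl) (sym x≡W))
      W-injective {fsuc s} {fzero}  W≡x = ⊥-elim (fresh (proj₁ (proj₂ (H s))) (here refl) W≡x)
      W-injective {fsuc s} {fsuc t} W≡W with H s | H t
      ... | e , e∈ , refl , _ | e′ , e′∈ , refl , _ =
        cong fsuc (toℕ-injective (suc-injective (functional e∈ e′∈ W≡W)))

    nextId≤k : smallestPos (usedIds x acc) ≤ k
    nextId≤k = clique-of-holders _ holder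

    invariant-step : Invariant ((x , smallestPos (usedIds x acc)) ∷ acc) xs
    invariant-step = record
      { functional = functional′
      ; fresh      = fresh′
      ; earlier    = earlier′
      ; unique     = AllPairs.tail unique
      ; sorted     = AllPairs.tail sorted
      }
      where
      acc′ : List (Fin n × ℕ)
      acc′ = (x , smallestPos (usedIds x acc)) ∷ acc
      functional′ : ∀ {e e′} → e ∈ acc′ → e′ ∈ acc′ → proj₁ e ≡ proj₁ e′ → proj₂ e ≡ proj₂ e′
      functional′ (here refl) (here refl) _  = refl
      functional′ (here refl) (there e′∈) eq = ⊥-elim (fresh e′∈ (here refl) (sym eq))
      functional′ (there e∈)  (here refl) eq = ⊥-elim (fresh e∈ (here refl) eq)
      functional′ (there e∈)  (there e′∈) eq = functional e∈ e′∈ eq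
      fresh′ : ∀ {e y} → e ∈ acc′ → y ∈ xs → proj₁ e ≢ y
      fresh′ (here refl) y∈ = All.lookup (AllPairs.head unique) y∈
      fresh′ (there e∈)  y∈ = fresh e∈ (there y∈)
      earlier′ : ∀ {e y} → e ∈ acc′ → y ∈ xs → left (I (proj₁ e)) ≤ left (I y)
      earlier′ (here refl) y∈ = All.lookup (AllPairs.head sorted) y∈
      earlier′ (there e∈)  y∈ = earlier e∈ (there y∈)

  numIds-assignIds≤ : ∀ {acc rest} → Invariant acc rest → numIds I acc ≤ k → numIds I (assignIds I acc rest) ≤ k
  numIds-assignIds≤ {rest = []}     _   acc≤k = acc≤k
  numIds-assignIds≤ {rest = x ∷ xs} inv acc≤k =
    numIds-assignIds≤ (invariant-step inv) (⊔-lub (nextId≤k inv) acc≤k)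

  firstFit-numIds≤ : ∀ {P} → Unique P → Sorted P → numIds I (assignIds I [] P) ≤ k
  firstFit-numIds≤ {P} P! P-sorted = numIds-assignIds≤ inv z≤n
    where
    inv : Invariant [] P
    inv = record { functional = λ (); fresh = λ (); earlier = λ (); unique = P!; sorted = P-sorted }

assignIds-keys : ∀ {n} (I : Fin n → Interval) acc P → map proj₁ (assignIds I acc P) ↭ P ++ map proj₁ acc
assignIds-keys I acc []       = ↭-refl
assignIds-keys I acc (x ∷ xs) = ↭-trans (assignIds-keys I _ xs) (shift x xs (map proj₁ acc))

module _ {n : ℕ} (I : Fin n → Interval) where

  totalCost-classes≤ : ∀ ids {is} → Unique is →
    sum (map totalCost (map (λ i → sortByCost (listOf I ids i)) is)) ≤ sum (map (cost ∘ I ∘ proj₁) ids)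
  totalCost-classes≤ ids {is} is! = begin
    sum (map totalCost (map (λ i → sortByCost (listOf I ids i)) is)) ≡⟨ cong sum (map-∘ is) ⟨
    sum (map (λ i → totalCost (sortByCost (listOf I ids i))) is)     ≡⟨ cong sum (map-cong class-cost is) ⟩
    sum (map (λ i → classWeight i ids) is)                           ≤⟨ sum-classWeight≤ is! ids ⟩
    sum (map (cost ∘ I ∘ proj₁) ids)                                 ∎
    where
    open ≤-Reasoning
    open Classes ℕ._≟_ proj₂ (cost ∘ I ∘ proj₁)
    class-cost : ∀ i → totalCost (sortByCost (listOf I ids i)) ≡ classWeight i ids
    class-cost i = trans (totalCost-sortByCost (listOf I ids i))
                         (cong sum (sym (map-∘ (filter (λ e → proj₂ e ℕ.≟ i) ids))))

  packAll-classes-bound : ∀ cap {b} → (∀ d → b ≤ cap d) → (∀ d i → cost (I i) ≤ cap d) → ∀ ids g →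
    packAll cap 0 (map (λ i → sortByCost (listOf I ids i)) (map suc (upTo g))) * b
      ≤ 2 * sum (map (cost ∘ I ∘ proj₁) ids) + g * b
  packAll-classes-bound cap {b} b≤cap fits ids g = begin
    packAll cap 0 Ls * b                         ≤⟨ packAll-bound 0 Ls Ls-fit ⟩
    2 * sum (map totalCost Ls) + length Ls * b   ≤⟨ +-mono-≤ (*-monoʳ-≤ 2 (totalCost-classes≤ ids js!))
                                                              (≤-reflexive (cong (_* b) length-Ls)) ⟩
    2 * sum (map (cost ∘ I ∘ proj₁) ids) + g * b ∎
    where
    open ≤-Reasoning
    open Packing cap b≤cap
    js : List ℕ
    js = map suc (upTo g)
    js! : Unique js
    js! = Unique.map⁺ suc-injective (Unique.upTo⁺ g)
    Ls : List (List Interval)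
    Ls = map (λ i → sortByCost (listOf I ids i)) js
    class-fits : ∀ i → All Fits (listOf I ids i)
    class-fits i = All-map⁺ {f = I ∘ proj₁} (All.universal (λ e d → fits d (proj₁ e)) _)
    Ls-fit : All (All Fits) Ls
    Ls-fit = All-map⁺ (All.universal (λ i → All-sortByCost (class-fits i)) js)
    length-Ls : length Ls ≡ g
    length-Ls = trans (length-map _ js) (trans (length-map suc (upTo g)) (length-upTo g))

  assignIds-totalCost : ∀ {P} → P ↭ allFin n →
    sum (map (cost ∘ I ∘ proj₁) (assignIds I [] P)) ≡ sum (map (cost ∘ I) (allFin n))
  assignIds-totalCost {P} P↭ = begin
    sum (map (cost ∘ I ∘ proj₁) (assignIds I [] P))     ≡⟨ cong sum (map-∘ (assignIds I [] P)) ⟩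
    sum (map (cost ∘ I) (map proj₁ (assignIds I [] P))) ≡⟨ sum-↭ (↭-map⁺ (cost ∘ I) keys↭) ⟩
    sum (map (cost ∘ I) (allFin n))                     ∎
    where
    open ≡-Reasoning
    keys↭ : map proj₁ (assignIds I [] P) ↭ allFin n
    keys↭ = ↭-trans (assignIds-keys I [] P) (subst (_↭ allFin n) (sym (++-identityʳ P)) P↭)

  schedule-totalCost≤ : ∀ {cap k bmax} → OfflineSchedule I cap k → (∀ d → cap d ≤ bmax) →
    sum (map (cost ∘ I) (allFin n)) ≤ k * bmax
  schedule-totalCost≤ {cap} {k} {bmax} sch cap≤bmax = begin
    sum (map (cost ∘ I) (allFin n))                       ≤⟨ sum-classWeight≥ (∈-allFin ∘ colour) (allFin n) ⟩
    sum (map (λ c → classWeight c (allFin n)) (allFin k)) ≤⟨ sum-map-≤-length* _ load≤bmax (allFin k) ⟩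
    length (allFin k) * bmax                              ≡⟨ cong (_* bmax) (length-tabulate {n = k} (λ c → c)) ⟩
    k * bmax                                              ∎
    where
    open ≤-Reasoning
    open OfflineSchedule sch
    open Classes Fin._≟_ colour (cost ∘ I)
    load≤bmax : ∀ c → classWeight c (allFin n) ≤ bmax
    load≤bmax c = ≤-trans (capacity c) (cap≤bmax (drone c))

theorem3 : {n : ℕ} (I : Fin n → Interval)
    → (∀ i → left (I i) ≤ right (I i))
    → (∀ i → 0 < cost (I i))
    → (cap : ℕ → ℕ) (bmin bmax : ℕ)
    → (∀ d → bmin ≤ cap d) → ∃ (λ d → cap d ≡ bmin)
    → (∀ d → cap d ≤ bmax) → ∃ (λ d → cap d ≡ bmax)
    → (∀ d i → cost (I i) ≤ cap d)
    → (P : List (Fin n)) → P ↭ allFin n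
    → AllPairs (λ i j → left (I i) ≤ left (I j)) P
    → (k : ℕ) → OfflineSchedule I cap k
    → VariableSizeDS I P cap * bmin ≤ (2 * bmax + bmin) * k
theorem3 {n} I nonempty _ cap bmin bmax bmin≤cap _ cap≤bmax _ fits P P↭ P-sorted k sch = begin
  VariableSizeDS I P cap * bmin                   ≤⟨ packAll-classes-bound I cap bmin≤cap fits ids g ⟩
  2 * sum (map (cost ∘ I ∘ proj₁) ids) + g * bmin ≤⟨ +-mono-≤ (*-monoʳ-≤ 2 ids-cost≤) (*-monoˡ-≤ bmin g≤k) ⟩
  2 * (k * bmax) + k * bmin                       ≡⟨ solve 3 (λ k a b → con 2 :* (k :* a) :+ k :* b
                                                                       := (con 2 :* a :+ b) :* k)
                                                             refl k bmax bmin ⟩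
  (2 * bmax + bmin) * k                           ∎
  where
  open ≤-Reasoning
  open OfflineSchedule sch using (disjoint)
  ids : List (Fin n × ℕ)
  ids = assignIds I [] P
  g : ℕ
  g = numIds I ids
  ids-cost≤ : sum (map (cost ∘ I ∘ proj₁) ids) ≤ k * bmax
  ids-cost≤ = ≤-trans (≤-reflexive (assignIds-totalCost I P↭)) (schedule-totalCost≤ I sch cap≤bmax)
  P! : Unique P
  P! = Permutationₛ.Unique-resp-↭ (setoid (Fin n)) (↭⇒↭ₛ (↭-sym P↭)) (Unique.allFin⁺ n)
  g≤k : g ≤ k
  g≤k = FirstFit.firstFit-numIds≤ I nonempty (clique≤colours I disjoint) P! P-sorted
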